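{- Let $G=(C\cup I,E)$ be a connected split graph, where $C$ induces an inclusion-maximal clique and $I$ induces an independent set. Then $mh(G)=|C|-1$ if and only if there exists a simplicial vertex in $C$. Otherwise, $mh(G)=|C|$.
   Context: A vertex is simplicial if its neighbourhood induces a clique. Hunters and Rabbit game on a graph $G=(V,E)$. A hunter strategy is a finite sequence $(S_1,\dots,S_\ell)$ of non-empty subsets of $V$, using $\max_i|S_i|$ hunters. A rabbit trajectory is a walk $(r_0,\dots,r_\ell)$ in $G$ ($r_i\in N(r_{i-1})$); the strategy is winning if every rabbit trajectory has some $j<\ell$ with $r_j\in S_{j+1}$. Contaminated sets: $Z_0=V$, $Z_i=\{x : \exists y\in Z_{i-1}\setminus S_i,\ xy\in E\}$. A vertex $v$ is cleared at round $i$ if $v\in S_i$, or $N(v)\cap Z_{i-1}\ne\emptyset$ and $N(v)\cap Z_{i-1}\subseteq S_i$. A strategy is monotone if any vertex $v$ cleared at some round $i$ satisfies $v\in S_{j+1}$ whenever $j>i$ and $v\in Z_j$. $mh(G)$ is the minimum number of hunters of a monotone winning hunter strategy ($0$ for a single vertex). -}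

module Defs where

open import Data.Nat using (ℕ; zero; suc; _≤_; _<_)
open import Data.Bool using (Bool; T)
open import Data.Fin using (Fin)
open import Data.Fin.Subset using (Subset; _∈_; _∉_; _⊆_; ∣_∣; Nonempty)
open import Data.Product using (Σ; ∃; _×_)
open import Data.Empty using (⊥)
open import Data.Sum using (_⊎_)
open import Data.Unit using (⊤)
open import Relation.Nullary using (¬_)
open import Relation.Binary.PropositionalEquality using (_≡_; _≢_)

record Graph (n : ℕ) : Set where
  field
    adj   : Fin n → Fin n → Bool
    sym   : ∀ u v → adj u v ≡ adj v u
    irrefl : ∀ v → adj v v ≡ Data.Bool.false

open Graph public

E : ∀ {n} → Graph n → Fin n → Fin n → Set
E G u v = T (adj G u v)

-- a walk r_0, ..., r_ℓ is given by r : ℕ → Fin n (values after ℓ irrelevant)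
IsWalk : ∀ {n} → Graph n → ℕ → (ℕ → Fin n) → Set
IsWalk G ℓ r = ∀ i → i < ℓ → E G (r i) (r (suc i))

Connected : ∀ {n} → Graph n → Set
Connected G = ∀ u v → Σ ℕ λ ℓ → Σ _ λ r → IsWalk G ℓ r × r 0 ≡ u × r ℓ ≡ v

IsClique : ∀ {n} → Graph n → (Fin n → Set) → Set
IsClique G P = ∀ u v → P u → P v → u ≢ v → E G u v

IsIndependent : ∀ {n} → Graph n → (Fin n → Set) → Set
IsIndependent G P = ∀ u v → P u → P v → ¬ E G u v

IsMaximalClique : ∀ {n} → Graph n → Subset n → Set
IsMaximalClique G C =
  IsClique G (_∈ C) × (∀ K → IsClique G (_∈ K) → C ⊆ K → K ⊆ C)

Simplicial : ∀ {n} → Graph n → Fin n → Set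
Simplicial G v = IsClique G (E G v)

-- Hunter strategy (S_1, ..., S_ℓ): length ℓ and S : ℕ → Subset n, where S i
-- is the i-th set for 1 ≤ i ≤ ℓ (values at 0 and beyond ℓ are irrelevant).
record Strategy (n : ℕ) : Set where
  constructor strat
  field
    len : ℕ
    S   : ℕ → Subset n

open Strategy public

NonEmptySets : ∀ {n} → Strategy n → Set
NonEmptySets st = ∀ i → 1 ≤ i → i ≤ len st → Nonempty (S st i)

UsesAtMost : ∀ {n} → Strategy n → ℕ → Set
UsesAtMost st k = ∀ i → 1 ≤ i → i ≤ len st → ∣ S st i ∣ ≤ k

Winning : ∀ {n} → Graph n → Strategy n → Set
Winning G st = ∀ r → IsWalk G (len st) r →
  Σ ℕ λ j → j < len st × r j ∈ S st (suc j)

Z : ∀ {n} → Graph n → Strategy n → ℕ → Fin n → Set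
Z G st zero    x = ⊤
Z G st (suc i) x = Σ _ λ y → Z G st i y × y ∉ S st (suc i) × E G x y

ClearedAt : ∀ {n} → Graph n → Strategy n → Fin n → ℕ → Set
ClearedAt G st v zero    = ⊥
ClearedAt G st v (suc i) =
  v ∈ S st (suc i)
  ⊎ ((Σ _ λ y → E G v y × Z G st i y)
        × (∀ y → E G v y → Z G st i y → y ∈ S st (suc i)))

Monotone : ∀ {n} → Graph n → Strategy n → Set
Monotone G st = ∀ v i j → i ≤ len st → ClearedAt G st v i →
  i < j → j < len st → Z G st j v → v ∈ S st (suc j)

HasMonotoneWinning : ∀ {n} → Graph n → ℕ → Set
HasMonotoneWinning G k = Σ _ λ st →
  NonEmptySets st × Winning G st × Monotone G st × UsesAtMost st k

MH≡ : ∀ {n} → Graph n → ℕ → Set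
MH≡ {n} G k = (n ≡ 1 → k ≡ 0) ×
  (n ≢ 1 → HasMonotoneWinning G k × (∀ j → HasMonotoneWinning G j → k ≤ j))

-- Guarding the clique C in two consecutive rounds catches every rabbit, since I is independent;
-- if v ∈ C is simplicial then N(v) ⊆ C by maximality, so C − v already suffices.  Conversely a
-- rabbit moving inside C escapes any |C| − 2 hunters.  Without a simplicial vertex every vertex
-- of C has a neighbour in I.  Suppose a monotone strategy uses fewer than |C| hunters and let t
-- be the first round after which some c ∈ C is clean.  Then C − c, and by counting nothing else,
-- is guarded at round t + 1.  The I-neighbours of c were thus already clean after round t, hence
-- cleared; one of them is recontaminated through the unguarded c and must be guarded at round
-- t + 2, which leaves some d ∈ C − c unguarded.  Repeating the argument with an I-neighbour y
-- of d, monotonicity forces y and all of C − d to be guarded at round t + 3: |C| hunters.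
module Submission where

open import Defs
open import Data.Bool using (T)
open import Data.Empty using (⊥; ⊥-elim)
open import Data.Fin using (Fin; zero; suc; punchIn; _≟_)
open import Data.Fin.Properties using (any?; all?; suc-injective; punchInᵢ≢i)
open import Data.Fin.Subset
  using (Subset; inside; outside; _∈_; _∉_; _⊆_; _∪_; _-_; ⁅_⁆; ∣_∣; Nonempty)
  renaming (⊥ to ∅)
open import Data.Fin.Subset.Properties
  using ( _∈?_; drop-there; p⊆q⇒∣p∣≤∣q∣; ∣p∣≤∣x∷p∣; ∣p∣≤n; ∣⊥∣≡0; x∈p⇒∣p-x∣<∣p∣
        ; x∈p∧x≢y⇒x∈p-y; x∈⁅x⁆; x∈⁅y⁆⇒x≡y; p⊆p∪q; x∈p∪q⁻; x∈p∪q⁺ )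
open import Data.Nat
  using (ℕ; zero; suc; pred; _+_; _∸_; _≤_; _<_; _≤′_; ≤′-refl; ≤′-step; z≤n; s≤s; _≤?_; _<?_)
  renaming (_≟_ to _≟ℕ_)
open import Data.Nat.Properties
  using ( ≤-refl; ≤-trans; ≤-<-trans; ≤-pred; <⇒≤; <⇒≱; <⇒≤pred; ≮⇒≥; ≰⇒>
        ; ≤⇒≤′; n≤1+n; m≤n⇒m≤1+n; n<1+n; pred[n]≤n; m≤n⇒m<n∨m≡n; m≤n⇒m∸n≡0
        ; ∸-monoˡ-≤; 1+n≰n )
open import Data.Product using (Σ; ∃; _×_; _,_; proj₁; proj₂)
open import Data.Sum using (_⊎_; inj₁; inj₂; swap; [_,_]′)
open import Data.Unit using (tt)
open import Data.Vec using (_∷_; here; there)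
open import Function using (_∘_)
open import Function.Bundles using (_⇔_; mk⇔)
open import Relation.Nullary using (¬_; Dec; yes; no)
open import Relation.Nullary.Decidable using (decidable-stable; _×-dec_; _→-dec_; ¬?; T?)
open import Relation.Binary.PropositionalEquality as ≡
  using (_≡_; _≢_; refl; trans; subst; subst₂; ≢-sym)

SimplicialVertexIn : ∀ {n} → Graph n → Subset n → Set
SimplicialVertexIn G C = Σ _ λ v → v ∈ C × Simplicial G v

infix 4 _⊆_∪⁅_⁆

_⊆_∪⁅_⁆ : ∀ {n} → Subset n → Subset n → Fin n → Set
p ⊆ q ∪⁅ x ⁆ = ∀ {v} → v ∈ p → v ≢ x → v ∈ q

⊆∪⁅⁆⇒⊆ : ∀ {n} {p q : Subset n} {x} → p ⊆ q ∪⁅ x ⁆ → x ∈ q → p ⊆ q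
⊆∪⁅⁆⇒⊆ {x = x} p⊆q∪x x∈q {v} v∈p with v ≟ x
... | yes refl = x∈q
... | no  v≢x  = p⊆q∪x v∈p v≢x

⊆∪⁅⁆⇒∣p∣≤1+∣q∣ : ∀ {n} {p q : Subset n} x → p ⊆ q ∪⁅ x ⁆ → ∣ p ∣ ≤ suc ∣ q ∣
⊆∪⁅⁆⇒∣p∣≤1+∣q∣ {p = outside ∷ p} {s ∷ q} zero h =
  m≤n⇒m≤1+n (≤-trans (p⊆q⇒∣p∣≤∣q∣ (λ v∈p → drop-there (h (there v∈p) λ ()))) (∣p∣≤∣x∷p∣ s q))
⊆∪⁅⁆⇒∣p∣≤1+∣q∣ {p = inside ∷ p} {s ∷ q} zero h =
  s≤s (≤-trans (p⊆q⇒∣p∣≤∣q∣ (λ v∈p → drop-there (h (there v∈p) λ ()))) (∣p∣≤∣x∷p∣ s q))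
⊆∪⁅⁆⇒∣p∣≤1+∣q∣ {p = outside ∷ p} {s ∷ q} (suc x) h =
  ≤-trans (⊆∪⁅⁆⇒∣p∣≤1+∣q∣ x (λ v∈p v≢x → drop-there (h (there v∈p) (v≢x ∘ suc-injective))))
          (s≤s (∣p∣≤∣x∷p∣ s q))
⊆∪⁅⁆⇒∣p∣≤1+∣q∣ {p = inside ∷ p} {inside ∷ q} (suc x) h =
  s≤s (⊆∪⁅⁆⇒∣p∣≤1+∣q∣ x (λ v∈p v≢x → drop-there (h (there v∈p) (v≢x ∘ suc-injective))))
⊆∪⁅⁆⇒∣p∣≤1+∣q∣ {p = inside ∷ p} {outside ∷ q} (suc x) h with () ← h here (λ ())

⊆∪⁅⁆∧y∈q∖p⇒∣p∣≤∣q∣ : ∀ {n} {p q : Subset n} {x y} →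
  p ⊆ q ∪⁅ x ⁆ → y ∈ q → y ∉ p → ∣ p ∣ ≤ ∣ q ∣
⊆∪⁅⁆∧y∈q∖p⇒∣p∣≤∣q∣ {q = q} {x} {y} p⊆q∪x y∈q y∉p =
  ≤-trans (⊆∪⁅⁆⇒∣p∣≤1+∣q∣ {q = q - y} x λ v∈p v≢x → x∈p∧x≢y⇒x∈p-y (p⊆q∪x v∈p v≢x) λ { refl → y∉p v∈p })
          (x∈p⇒∣p-x∣<∣p∣ y∈q)

m≰pred[m] : ∀ {m} → 0 < m → ¬ m ≤ pred m
m≰pred[m] (s≤s _) = 1+n≰n

extendAfter : ∀ {A : Set} → (ℕ → A) → ℕ → A → ℕ → A
extendAfter r i x j with j ≤? i
... | yes _ = r j
... | no  _ = x

extendAfter-≤ : ∀ {A : Set} (r : ℕ → A) {i x j} → j ≤ i → extendAfter r i x j ≡ r j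
extendAfter-≤ r {i} {x} {j} j≤i with j ≤? i
... | yes _   = refl
... | no  j≰i = ⊥-elim (j≰i j≤i)

extendAfter-≰ : ∀ {A : Set} (r : ℕ → A) {i x j} → ¬ j ≤ i → extendAfter r i x j ≡ x
extendAfter-≰ r {i} {x} {j} j≰i with j ≤? i
... | yes j≤i = ⊥-elim (j≰i j≤i)
... | no  _   = refl

module _ {n} (G : Graph n) where

  E-sym : ∀ {u v} → E G u v → E G v u
  E-sym {u} {v} = subst T (sym G u v)

  E-irrefl : ∀ {v} → ¬ E G v v
  E-irrefl {v} = subst T (irrefl G v)

  E⇒≢ : ∀ {u v} → E G u v → u ≢ v
  E⇒≢ e refl = E-irrefl e

  E? : ∀ u v → Dec (E G u v)
  E? u v = T? (adj G u v)

  simplicial? : ∀ v → Dec (Simplicial G v)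
  simplicial? v = all? λ u → all? λ w →
    E? v u →-dec (E? v w →-dec (¬? (u ≟ w) →-dec E? u w))

  neighbours⊆clique⇒simplicial : ∀ {K v} → IsClique G (_∈ K) →
    (∀ {w} → E G v w → w ∈ K) → Simplicial G v
  neighbours⊆clique⇒simplicial K-clique N⊆K u w v~u v~w = K-clique u w (N⊆K v~u) (N⊆K v~w)

  clique-∪⁅⁆ : ∀ {K w} → IsClique G (_∈ K) → (∀ {a} → a ∈ K → a ≢ w → E G a w) →
    IsClique G (_∈ K ∪ ⁅ w ⁆)
  clique-∪⁅⁆ {K} {w} K-clique K~w a b a∈ b∈ a≢b with x∈p∪q⁻ K ⁅ w ⁆ a∈ | x∈p∪q⁻ K ⁅ w ⁆ b∈
  ... | inj₁ a∈K | inj₁ b∈K = K-clique a b a∈K b∈K a≢b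
  ... | inj₁ a∈K | inj₂ b∈w with refl ← x∈⁅y⁆⇒x≡y w b∈w = K~w a∈K a≢b
  ... | inj₂ a∈w | inj₁ b∈K with refl ← x∈⁅y⁆⇒x≡y w a∈w = E-sym (K~w b∈K (≢-sym a≢b))
  ... | inj₂ a∈w | inj₂ b∈w = ⊥-elim (a≢b (trans (x∈⁅y⁆⇒x≡y w a∈w) (≡.sym (x∈⁅y⁆⇒x≡y w b∈w))))

  simplicial∈maximal⇒N⊆C : ∀ {C v w} → IsMaximalClique G C → v ∈ C → Simplicial G v →
    E G v w → w ∈ C
  simplicial∈maximal⇒N⊆C {C} {v} {w} (C-clique , maximal) v∈C v-simplicial v~w =
    maximal (C ∪ ⁅ w ⁆) (clique-∪⁅⁆ C-clique C~w) (p⊆p∪q ⁅ w ⁆) (x∈p∪q⁺ (inj₂ (x∈⁅x⁆ w)))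
    where
    C~w : ∀ {a} → a ∈ C → a ≢ w → E G a w
    C~w {a} a∈C a≢w with a ≟ v
    ... | yes refl = v~w
    ... | no  a≢v  = v-simplicial a w (C-clique v a v∈C a∈C (≢-sym a≢v)) v~w a≢w

  IsVertexCover : Subset n → Set
  IsVertexCover K = ∀ {u v} → E G u v → u ∈ K ⊎ v ∈ K

  vertexCover⇒N⊆ : ∀ {K u v} → IsVertexCover K → u ∉ K → E G u v → v ∈ K
  vertexCover⇒N⊆ cover u∉K e with cover e
  ... | inj₁ u∈K = ⊥-elim (u∉K u∈K)
  ... | inj₂ v∈K = v∈K

  independentComplement⇒vertexCover : ∀ {C} → IsIndependent G (_∉ C) → IsVertexCover C
  independentComplement⇒vertexCover {C} indep {u} {v} e with u ∈? C | v ∈? C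
  ... | yes u∈C | _       = inj₁ u∈C
  ... | no  _   | yes v∈C = inj₂ v∈C
  ... | no  u∉C | no  v∉C = ⊥-elim (indep u v u∉C v∉C e)

  simplicial⇒vertexCover-C-v : ∀ {C v} → IsMaximalClique G C → IsIndependent G (_∉ C) →
    v ∈ C → Simplicial G v → IsVertexCover (C - v)
  simplicial⇒vertexCover-C-v {C} {v} C-max indep v∈C v-simplicial e =
    [ cover e , swap ∘ cover (E-sym e) ]′ (independentComplement⇒vertexCover indep e)
    where
    cover : ∀ {a b} → E G a b → a ∈ C → a ∈ C - v ⊎ b ∈ C - v
    cover {a} e a∈C with a ≟ v
    ... | no  a≢v  = inj₁ (x∈p∧x≢y⇒x∈p-y a∈C a≢v)
    ... | yes refl =
      inj₂ (x∈p∧x≢y⇒x∈p-y (simplicial∈maximal⇒N⊆C C-max v∈C v-simplicial e) (≢-sym (E⇒≢ e)))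

  twoRounds : Subset n → Strategy n
  twoRounds K = strat 2 (λ _ → K)

  vertexCover⇒winning : ∀ {K} → IsVertexCover K → Winning G (twoRounds K)
  vertexCover⇒winning cover r walk with cover (walk 0 (s≤s z≤n))
  ... | inj₁ r₀∈K = 0 , s≤s z≤n , r₀∈K
  ... | inj₂ r₁∈K = 1 , s≤s (s≤s z≤n) , r₁∈K

  twoRounds-monotone : ∀ K → Monotone G (twoRounds K)
  twoRounds-monotone K v zero    _             _ () _        _
  twoRounds-monotone K v (suc i) zero          _ _  ()       _
  twoRounds-monotone K v (suc i) (suc zero)    _ _  (s≤s ()) _
  twoRounds-monotone K v (suc i) (suc (suc j)) _ _  _        (s≤s (s≤s ()))

  vertexCover⇒hasMonotoneWinning : ∀ {K k} → IsVertexCover K → Nonempty K → ∣ K ∣ ≤ k →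
    HasMonotoneWinning G k
  vertexCover⇒hasMonotoneWinning {K} cover K≢∅ ∣K∣≤k =
    twoRounds K , (λ _ _ _ → K≢∅) , vertexCover⇒winning cover , twoRounds-monotone K , λ _ _ _ → ∣K∣≤k

module Contamination {n} (G : Graph n) (st : Strategy n) where

  Z? : ∀ i x → Dec (Z G st i x)
  Z? zero    x = yes tt
  Z? (suc i) x = any? λ y → Z? i y ×-dec ¬? (y ∈? S st (suc i)) ×-dec E? G x y

  Z-downward : ∀ {k i x} → k ≤′ i → Z G st i x → ∃ (Z G st k)
  Z-downward ≤′-refl        zx           = _ , zx
  Z-downward (≤′-step k≤′i) (_ , zy , _) = Z-downward k≤′i zy

  Survives : ℕ → (ℕ → Fin n) → Set
  Survives i r = ∀ j → j < i → r j ∉ S st (suc j)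

  contaminated⇒survivingWalk : ∀ i {x} → Z G st i x →
    Σ (ℕ → Fin n) λ r → IsWalk G i r × Survives i r × r i ≡ x
  contaminated⇒survivingWalk zero {x} _ = (λ _ → x) , (λ _ ()) , (λ _ ()) , refl
  contaminated⇒survivingWalk (suc i) {x} (y , zy , y∉S , x~y)
    with contaminated⇒survivingWalk i zy
  ... | r , walk , survives , refl =
    extendAfter r i x , walk′ , survives′ , extendAfter-≰ r {i} 1+n≰n
    where
    walk′ : IsWalk G (suc i) (extendAfter r i x)
    walk′ j (s≤s j≤i) with m≤n⇒m<n∨m≡n j≤i
    ... | inj₁ j<i = subst₂ (E G) (≡.sym (extendAfter-≤ r j≤i)) (≡.sym (extendAfter-≤ r j<i)) (walk j j<i)
    ... | inj₂ refl =
      subst₂ (E G) (≡.sym (extendAfter-≤ r j≤i)) (≡.sym (extendAfter-≰ r {j} 1+n≰n)) (E-sym G x~y)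
    survives′ : Survives (suc i) (extendAfter r i x)
    survives′ j (s≤s j≤i) rewrite extendAfter-≤ r {x = x} j≤i with m≤n⇒m<n∨m≡n j≤i
    ... | inj₁ j<i  = survives j j<i
    ... | inj₂ refl = y∉S

  winning⇒¬survives : Winning G st → ∀ {r} → IsWalk G (len st) r → ¬ Survives (len st) r
  winning⇒¬survives win walk survives with win _ walk
  ... | j , j<ℓ , caught = survives j j<ℓ caught

  winning⇒¬Z[len] : Winning G st → ∀ {x} → ¬ Z G st (len st) x
  winning⇒¬Z[len] win zx =
    let _ , walk , survives , _ = contaminated⇒survivingWalk (len st) zx
    in winning⇒¬survives win walk survives

  winning⇒Z⇒<len : Winning G st → ∀ {i x} → Z G st i x → i < len st
  winning⇒Z⇒<len win {i} zx = decidable-stable (i <? len st) λ i≮ℓ →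
    winning⇒¬Z[len] win (proj₂ (Z-downward (≤⇒≤′ (≮⇒≥ i≮ℓ)) zx))

  -- Clearing at round t = suc t′ looks at Z t′ = Z (pred t); for t = 0 the premise ¬ Z 0 w fails.
  leavingZ⇒cleared : ∀ t {w y} → E G w y → Z G st (pred t) y → ¬ Z G st t w → ClearedAt G st w t
  leavingZ⇒cleared zero    _   _  w∉Z₀ = ⊥-elim (w∉Z₀ tt)
  leavingZ⇒cleared (suc t) w~y zy w∉Z  = inj₂ ((_ , w~y , zy) , λ u w~u zu →
    decidable-stable (u ∈? S st (suc t)) λ u∉S → w∉Z (u , zu , u∉S , w~u))

  ContaminatedThrough : Subset n → ℕ → Set
  ContaminatedThrough K t = ∀ s → s ≤ t → ∀ {v} → v ∈ K → Z G st s v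

  FirstCleanRound : Subset n → Set
  FirstCleanRound K =
    Σ ℕ λ t → Σ (Fin n) λ c → c ∈ K × ¬ Z G st (suc t) c × ContaminatedThrough K t

  firstCleanRound : ∀ K k → ContaminatedThrough K k ⊎ FirstCleanRound K
  firstCleanRound K zero = inj₁ λ { zero z≤n _ → tt }
  firstCleanRound K (suc k) with firstCleanRound K k
  ... | inj₂ first = inj₂ first
  ... | inj₁ through-k with any? (λ c → c ∈? K ×-dec ¬? (Z? (suc k) c))
  ...   | yes (c , c∈K , c∉Z) = inj₂ (k , c , c∈K , c∉Z , through-k)
  ...   | no  none            = inj₁ through-1+k
    where
    through-1+k : ContaminatedThrough K (suc k)
    through-1+k s s≤1+k {v} v∈K with m≤n⇒m<n∨m≡n s≤1+k
    ... | inj₁ s<1+k = through-k s (≤-pred s<1+k) v∈K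
    ... | inj₂ refl  = decidable-stable (Z? (suc k) v) λ v∉Z → none (v , v∈K , v∉Z)

  winning⇒firstCleanRound : Winning G st → ∀ {K} → Nonempty K → FirstCleanRound K
  winning⇒firstCleanRound win {K} (c , c∈K) with firstCleanRound K (len st)
  ... | inj₁ through = ⊥-elim (winning⇒¬Z[len] win (through (len st) ≤-refl c∈K))
  ... | inj₂ first   = first

module _ {n} (G : Graph (suc n)) {K : Subset (suc n)} (K-clique : IsClique G (_∈ K)) where

  escapeIn : ∀ H a → 2 + ∣ H ∣ ≤ ∣ K ∣ → ∃ λ v → v ∈ K × v ≢ a × v ∉ H
  escapeIn H a room = decidable-stable (any? λ v → v ∈? K ×-dec ¬? (v ≟ a) ×-dec ¬? (v ∈? H))
    λ none → <⇒≱ room (⊆∪⁅⁆⇒∣p∣≤1+∣q∣ a λ v∈K v≢a →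
      decidable-stable (_ ∈? H) λ v∉H → none (_ , v∈K , v≢a , v∉H))

  private
    module Rabbit (st : Strategy (suc n)) (2≤∣K∣ : 2 ≤ ∣ K ∣) where

      -- The rabbit must keep moving inside K in every round, but needs to dodge the hunters H
      -- only in the rounds of the strategy, where H leaves room.
      Move : Subset (suc n) → Fin (suc n) → Set
      Move H a = Σ (Fin (suc n)) λ v → v ∈ K × v ≢ a × (2 + ∣ H ∣ ≤ ∣ K ∣ → v ∉ H)

      move : ∀ H a → Move H a
      move H a with 2 + ∣ H ∣ ≤? ∣ K ∣
      ... | yes room = let v , v∈K , v≢a , v∉H = escapeIn H a room in v , v∈K , v≢a , λ _ → v∉H
      ... | no  full = let v , v∈K , v≢a , _ = escapeIn ∅ a 2+∣∅∣≤∣K∣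
                       in v , v∈K , v≢a , λ room → ⊥-elim (full room)
        where
        2+∣∅∣≤∣K∣ : 2 + ∣ ∅ {suc n} ∣ ≤ ∣ K ∣
        2+∣∅∣≤∣K∣ = subst (λ m → 2 + m ≤ ∣ K ∣) (≡.sym (∣⊥∣≡0 (suc n))) 2≤∣K∣

      -- trail 0 is a dummy predecessor; the rabbit starts at trail 1.
      trail : ℕ → Fin (suc n)
      trail zero    = zero
      trail (suc j) = proj₁ (move (S st (suc j)) (trail j))

      rabbit : ℕ → Fin (suc n)
      rabbit = trail ∘ suc

      rabbit-walk : IsWalk G (len st) rabbit
      rabbit-walk j _ =
        let _ , r₀∈K , _      , _ = move (S st (suc j)) (trail j)
            _ , r₁∈K , r₁≢r₀ , _ = move (S st (suc (suc j))) (rabbit j)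
        in K-clique _ _ r₀∈K r₁∈K (≢-sym r₁≢r₀)

      rabbit-survives : (∀ j → j < len st → 2 + ∣ S st (suc j) ∣ ≤ ∣ K ∣) →
        Contamination.Survives G st (len st) rabbit
      rabbit-survives room j j<ℓ = proj₂ (proj₂ (proj₂ (move (S st (suc j)) (trail j)))) (room j j<ℓ)

  winning⇒∣clique∣≤1+hunters : ∀ {st k} → Winning G st → UsesAtMost st k → ∣ K ∣ ≤ suc k
  winning⇒∣clique∣≤1+hunters {st} {k} win uses = decidable-stable (∣ K ∣ ≤? suc k) λ ∣K∣≰1+k →
    let 2+k≤∣K∣ = ≰⇒> ∣K∣≰1+k
        open Rabbit st (≤-trans (s≤s (s≤s z≤n)) 2+k≤∣K∣)
    in Contamination.winning⇒¬survives G st win rabbit-walk (rabbit-survives λ j j<ℓ →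
         ≤-trans (s≤s (s≤s (uses (suc j) (s≤s z≤n) j<ℓ))) 2+k≤∣K∣)

module NoSimplicialLowerBound {n} (G : Graph n) {C : Subset n}
    (C-clique : IsClique G (_∈ C)) (indep : IsIndependent G (_∉ C))
    (no-simplicial : ¬ SimplicialVertexIn G C)
    {st : Strategy n} (win : Winning G st) (mono : Monotone G st)
    (few : ∀ j → j < len st → ∣ S st (suc j) ∣ < ∣ C ∣) where

  open Contamination G st

  outerNeighbour : ∀ {c} → c ∈ C → ∃ λ x → E G c x × x ∉ C
  outerNeighbour {c} c∈C = decidable-stable (any? λ x → E? G c x ×-dec ¬? (x ∈? C)) λ none →
    no-simplicial (c , c∈C , neighbours⊆clique⇒simplicial G C-clique λ {w} c~w →
      decidable-stable (w ∈? C) λ w∉C → none (w , c~w , w∉C))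

  N⊆C : ∀ {y u} → y ∉ C → E G y u → u ∈ C
  N⊆C = vertexCover⇒N⊆ G (independentComplement⇒vertexCover G indep)

  crowded : ∀ {j d y} → j < len st → C ⊆ S st (suc j) ∪⁅ d ⁆ → y ∈ S st (suc j) → y ∉ C → ⊥
  crowded j<ℓ C⊆S∪d y∈S y∉C = <⇒≱ (few _ j<ℓ) (⊆∪⁅⁆∧y∈q∖p⇒∣p∣≤∣q∣ C⊆S∪d y∈S y∉C)

  module AtFirstCleanRound {t c} (c∈C : c ∈ C) (c∉Z : ¬ Z G st (suc t) c)
                           (C⊆Z : ContaminatedThrough C t) where

    S₁ S₂ S₃ : Subset n
    S₁ = S st (suc t)
    S₂ = S st (2 + t)
    S₃ = S st (3 + t)

    t<ℓ : t < len st
    t<ℓ = winning⇒Z⇒<len win (C⊆Z t ≤-refl c∈C)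

    C⊆S₁∪c : C ⊆ S₁ ∪⁅ c ⁆
    C⊆S₁∪c {v} v∈C v≢c = decidable-stable (v ∈? S₁) λ v∉S₁ →
      c∉Z (v , C⊆Z t ≤-refl v∈C , v∉S₁ , C-clique c v c∈C v∈C (≢-sym v≢c))

    c∉S₁ : c ∉ S₁
    c∉S₁ c∈S₁ = <⇒≱ (few t t<ℓ) (p⊆q⇒∣p∣≤∣q∣ (⊆∪⁅⁆⇒⊆ C⊆S₁∪c c∈S₁))

    outerNeighbourOfC-cleared : ∀ {w} → E G w c → w ∉ C → ClearedAt G st w t
    outerNeighbourOfC-cleared w~c w∉C =
      leavingZ⇒cleared t w~c (C⊆Z (pred t) pred[n]≤n c∈C) λ w∈Z →
        c∉Z (_ , w∈Z , (λ w∈S₁ → crowded t<ℓ C⊆S₁∪c w∈S₁ w∉C) , E-sym G w~c)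

    unguarded : ∃ λ d → d ∈ C × d ≢ c × d ∉ S₂
    unguarded =
      let x , c~x , x∉C = outerNeighbour c∈C
          x∈Z : Z G st (suc t) x
          x∈Z = c , C⊆Z t ≤-refl c∈C , c∉S₁ , E-sym G c~x
          1+t<ℓ = winning⇒Z⇒<len win x∈Z
          x∈S₂ = mono x t (suc t) (<⇒≤ t<ℓ) (outerNeighbourOfC-cleared (E-sym G c~x) x∉C)
                   (n<1+n t) 1+t<ℓ x∈Z
      in decidable-stable (any? λ d → d ∈? C ×-dec ¬? (d ≟ c) ×-dec ¬? (d ∈? S₂)) λ none →
           crowded 1+t<ℓ (λ {v} v∈C v≢c → decidable-stable (v ∈? S₂) λ v∉S₂ →
             none (v , v∈C , v≢c , v∉S₂)) x∈S₂ x∉C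

    module _ {d} (d∈C : d ∈ C) (d≢c : d ≢ c) (d∉S₂ : d ∉ S₂) where

      d∈Z : Z G st (suc t) d
      d∈Z = c , C⊆Z t ≤-refl c∈C , c∉S₁ , C-clique d c d∈C c∈C d≢c

      clique-cleared : ∀ {v} → v ∈ C → ClearedAt G st v (suc t)
      clique-cleared {v} v∈C with v ≟ c
      ... | yes refl = leavingZ⇒cleared (suc t) (C-clique c d c∈C d∈C (≢-sym d≢c)) (C⊆Z t ≤-refl d∈C) c∉Z
      ... | no  v≢c  = inj₁ (C⊆S₁∪c v∈C v≢c)

      outerNeighbourOfD-cleared : ∀ {y} → E G y d → y ∉ C → Σ ℕ λ i → i ≤ suc t × ClearedAt G st y i
      outerNeighbourOfD-cleared {y} y~d y∉C with E? G y c
      ... | yes y~c = t , n≤1+n t , outerNeighbourOfC-cleared y~c y∉C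
      ... | no  y≁c = suc t , ≤-refl , inj₂ ((d , y~d , C⊆Z t ≤-refl d∈C) , λ u y~u _ →
            C⊆S₁∪c (N⊆C y∉C y~u) λ { refl → y≁c y~u })

      S₃-overfull : ⊥
      S₃-overfull =
        let y , d~y , y∉C = outerNeighbour d∈C
            y∈Z : Z G st (2 + t) y
            y∈Z = d , d∈Z , d∉S₂ , E-sym G d~y
            2+t<ℓ = winning⇒Z⇒<len win y∈Z
            i , i≤1+t , y-cleared = outerNeighbourOfD-cleared (E-sym G d~y) y∉C
            y∈S₃ = mono y i (2 + t) (≤-trans i≤1+t t<ℓ) y-cleared (s≤s i≤1+t) 2+t<ℓ y∈Z
            C⊆S₃∪d : C ⊆ S₃ ∪⁅ d ⁆
            C⊆S₃∪d = λ {v} v∈C v≢d → mono v (suc t) (2 + t) t<ℓ (clique-cleared v∈C) (n<1+n _) 2+t<ℓ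
                       (d , d∈Z , d∉S₂ , C-clique v d v∈C d∈C v≢d)
        in crowded 2+t<ℓ C⊆S₃∪d y∈S₃ y∉C

  absurd : Nonempty C → ⊥
  absurd C≢∅ =
    let t , c , c∈C , c∉Z , C⊆Z = winning⇒firstCleanRound win C≢∅
        open AtFirstCleanRound c∈C c∉Z C⊆Z
        d , d∈C , d≢c , d∉S₂ = unguarded
    in S₃-overfull d∈C d≢c d∉S₂

noSimplicial⇒∣C∣≤hunters : ∀ {n} (G : Graph n) {C k} → IsClique G (_∈ C) → IsIndependent G (_∉ C) →
  ¬ SimplicialVertexIn G C → Nonempty C → HasMonotoneWinning G k → ∣ C ∣ ≤ k
noSimplicial⇒∣C∣≤hunters G {C} {k} C-clique indep no-simplicial C≢∅ (st , _ , win , mono , uses) =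
  decidable-stable (∣ C ∣ ≤? k) λ ∣C∣≰k →
    NoSimplicialLowerBound.absurd G C-clique indep no-simplicial win mono
      (λ j j<ℓ → ≤-<-trans (uses (suc j) (s≤s z≤n) j<ℓ) (≰⇒> ∣C∣≰k)) C≢∅

maximal⇒nonempty : ∀ {n} (G : Graph (suc n)) {C} → IsMaximalClique G C → Nonempty C
maximal⇒nonempty G {C} (_ , maximal) = decidable-stable (any? (_∈? C)) λ C≡∅ →
  C≡∅ (zero , maximal ⁅ zero ⁆ ⁅0⁆-clique (λ v∈C → ⊥-elim (C≡∅ (_ , v∈C))) (x∈⁅x⁆ zero))
  where
  ⁅0⁆-clique : IsClique G (_∈ ⁅ zero ⁆)
  ⁅0⁆-clique a b a∈ b∈ a≢b = ⊥-elim (a≢b (trans (x∈⁅y⁆⇒x≡y zero a∈) (≡.sym (x∈⁅y⁆⇒x≡y zero b∈))))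

singleton⇒simplicial : ∀ {n} (G : Graph (suc n)) → suc n ≡ 1 → ∀ v → Simplicial G v
singleton⇒simplicial G refl zero zero _ v~u _ _ = ⊥-elim (E-irrefl G v~u)

connected⇒neighbour : ∀ {n} (G : Graph (suc n)) → Connected G → suc n ≢ 1 → ∀ v → ∃ (E G v)
connected⇒neighbour {zero}  G conn 1≢1 v = ⊥-elim (1≢1 refl)
connected⇒neighbour {suc n} G conn _   v with conn v (punchIn v zero)
... | zero  , r , _    , r₀≡v , r₀≡u = ⊥-elim (punchInᵢ≢i v zero (trans (≡.sym r₀≡u) r₀≡v))
... | suc ℓ , r , walk , refl , _    = r 1 , walk 0 (s≤s z≤n)

module SplitGraph {n} (G : Graph (suc n)) {C : Subset (suc n)} (conn : Connected G)
    (C-max : IsMaximalClique G C) (indep : IsIndependent G (_∉ C)) where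

  C≢∅ : Nonempty C
  C≢∅ = maximal⇒nonempty G C-max

  c₀ : Fin (suc n)
  c₀ = proj₁ C≢∅

  c₀∈C : c₀ ∈ C
  c₀∈C = proj₂ C≢∅

  simplicial⇒MH≡∣C∣∸1 : SimplicialVertexIn G C → MH≡ G (∣ C ∣ ∸ 1)
  simplicial⇒MH≡∣C∣∸1 (v , v∈C , v-simplicial) =
    (λ n≡1 → m≤n⇒m∸n≡0 (subst (∣ C ∣ ≤_) n≡1 (∣p∣≤n C))) , λ n≢1 →
      let w , v~w = connected⇒neighbour G conn n≢1 v
          w∈C-v = x∈p∧x≢y⇒x∈p-y (simplicial∈maximal⇒N⊆C G C-max v∈C v-simplicial v~w) (≢-sym (E⇒≢ G v~w))
      in vertexCover⇒hasMonotoneWinning G (simplicial⇒vertexCover-C-v G C-max indep v∈C v-simplicial)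
           (w , w∈C-v) (<⇒≤pred (x∈p⇒∣p-x∣<∣p∣ v∈C)) ,
         λ j (st , _ , win , _ , uses) →
           ∸-monoˡ-≤ 1 (winning⇒∣clique∣≤1+hunters G (proj₁ C-max) {st} {j} win uses)

  noSimplicial⇒MH≡∣C∣ : ¬ SimplicialVertexIn G C → MH≡ G ∣ C ∣
  noSimplicial⇒MH≡∣C∣ none =
    (λ n≡1 → ⊥-elim (none (c₀ , c₀∈C , singleton⇒simplicial G n≡1 c₀))) , λ _ →
      vertexCover⇒hasMonotoneWinning G (independentComplement⇒vertexCover G indep) C≢∅ ≤-refl ,
      λ j → noSimplicial⇒∣C∣≤hunters G (proj₁ C-max) indep none C≢∅

  MH≡∣C∣∸1⇒simplicial : MH≡ G (∣ C ∣ ∸ 1) → SimplicialVertexIn G C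
  MH≡∣C∣∸1⇒simplicial (_ , mh) with suc n ≟ℕ 1
  ... | yes n≡1 = c₀ , c₀∈C , singleton⇒simplicial G n≡1 c₀
  ... | no  n≢1 = decidable-stable (any? λ v → v ∈? C ×-dec simplicial? G v) λ none →
    m≰pred[m] (≤-trans (s≤s z≤n) (x∈p⇒∣p-x∣<∣p∣ c₀∈C))
      (noSimplicial⇒∣C∣≤hunters G (proj₁ C-max) indep none C≢∅ (proj₁ (mh n≢1)))

theorem4p6 : ∀ {n} (G : Graph (suc n)) (C : Subset (suc n)) →
    Connected G → IsMaximalClique G C → IsIndependent G (_∉ C) →
    (MH≡ G (∣ C ∣ ∸ 1) ⇔ (Σ _ λ v → v ∈ C × Simplicial G v))
    × (¬ (Σ _ λ v → v ∈ C × Simplicial G v) → MH≡ G ∣ C ∣)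
theorem4p6 G C conn C-max indep =
  mk⇔ MH≡∣C∣∸1⇒simplicial simplicial⇒MH≡∣C∣∸1 , noSimplicial⇒MH≡∣C∣
  where open SplitGraph G conn C-max indep
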